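{- Let $n\ge 4$, $M_n=\{1,2,\dots,n\}$, and let $\mathcal{F}\subseteq 2^{M_n}$ be a union-closed family with $\emptyset\in\mathcal{F}$ and $\bigcup_{A\in\mathcal{F}}A=M_n$. Let $T(\mathcal{F})=\min\{1\le k\le n:\ \mathcal{F}\text{ contains a set of cardinality }k\}$. If $T(\mathcal{F})=n-2$, then there exist at least $n-2$ distinct elements $i\in M_n$ such that $|\{A\in\mathcal{F}: i\in A\}|\ge \tfrac12|\mathcal{F}|$.
   Context: A family $\mathcal{F}$ is union-closed if $A\cup B\in\mathcal{F}$ for all $A,B\in\mathcal{F}$. -}

module Defs where

open import Data.Nat using (ℕ; _≤_; _*_; _∸_)
open import Data.Fin using (Fin)
open import Data.Fin.Subset using (Subset; _∪_; ∣_∣; ⊥; ⊤) renaming (_∈_ to _∈ˢ_)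
open import Data.Fin.Subset.Properties using () renaming (_∈?_ to _∈ˢ?_)
open import Data.List using (List; length; filter)
open import Data.List.Membership.Propositional using () renaming (_∈_ to _∈ᶠ_)
open import Data.List.Relation.Unary.Unique.Propositional using (Unique)
open import Data.List.Relation.Unary.All using (All)
open import Data.Product using (Σ; _×_; ∃)
open import Relation.Binary.PropositionalEquality using (_≡_; _≢_)

record Family (n : ℕ) : Set where
  constructor family
  field
    sets   : List (Subset n)
    unique : Unique sets
open Family public

_∈F_ : {n : ℕ} → Subset n → Family n → Set
A ∈F F = A ∈ᶠ sets F

size : {n : ℕ} → Family n → ℕ
size F = length (sets F)

UnionClosed : {n : ℕ} → Family n → Set
UnionClosed F = ∀ A B → A ∈F F → B ∈F F → (A ∪ B) ∈F F

CoversAll : {n : ℕ} → Family n → Set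
CoversAll {n} F = ∀ (i : Fin n) → Σ (Subset n) λ A → A ∈F F × i ∈ˢ A

-- T(F) = k : F has a member of size k, and every member of size ≥ 1 has size ≥ k
-- (i.e. k = min{1 ≤ j : F contains a set of size j}; used with k = n-2 ≥ 2).
HasT : {n : ℕ} → Family n → ℕ → Set
HasT F k =
  (Σ _ λ A → A ∈F F × ∣ A ∣ ≡ k)
  × (∀ A → A ∈F F → 1 ≤ ∣ A ∣ → k ≤ ∣ A ∣)

freq : {n : ℕ} → Fin n → Family n → ℕ
freq i F = length (filter (i ∈ˢ?_) (sets F))

Abundant : {n : ℕ} → Family n → Fin n → Set
Abundant F i = size F ≤ 2 * freq i F

-- Every nonempty member of F has at least n − 2 elements. Fix three distinct
-- points x, y, z and classify the members by how they meet {x, y, z}: the only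
-- member meeting it in no point is ∅, the only member meeting it exactly in u
-- is M_n − {v, w}, and M_n ∈ F. If two of the latter kind exist, say with u = x
-- and u = y, their union meets {x, y, z} in {x, y}. Double counting the sum of
-- 2·|A ∩ {x, y, z}| − 3 over A ∈ F then gives 3|F| ≤ 2(f_x + f_y + f_z) + 2,
-- whereas three points of frequency below |F|/2 would give
-- 2(f_x + f_y + f_z) + 3 ≤ 3|F|. So at most two points are not abundant.
module Submission where

open import Defs
open import Data.Nat using (ℕ; _≤_; _∸_)
open import Data.Fin using (Fin)
open import Data.Fin.Subset using (⊥)
open import Data.List using (List; length)
open import Data.List.Relation.Unary.Unique.Propositional using (Unique)
open import Data.List.Relation.Unary.All using (All)
open import Data.Product using (Σ; _×_)

open import Data.Bool.Base using (Bool; true; false; T; not; _∧_)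
open import Data.Bool.Properties using (T-≡)
open import Data.Empty using (⊥-elim)
open import Data.Fin.Subset using (Subset; ⊤; _∪_; ⁅_⁆; ⋃; ∣_∣; _∈_; _∉_; _⊆_; _⊂_)
open import Data.Fin.Subset.Properties
  using (_∈?_; ∈⊤; ⊆⊤; ∉⊥; ∣p∣≤n; p⊂q⇒∣p∣<∣q∣; x∈p⇒∣p-x∣<∣p∣; ⊆-antisym; p⊆p∪q; q⊆p∪q;
         x∈p∪q⁺; x∈p∪q⁻; x∈⁅x⁆; x≢y⇒x∉⁅y⁆; Empty-unique)
open import Data.List using (_∷_; []; map; filter; allFin)
open import Data.List.Membership.Propositional using () renaming (_∈_ to _∈ᴸ_)
open import Data.List.Properties using (length-tabulate)
open import Data.List.Relation.Unary.All using (_∷_; []; lookup; tabulate; zipWith)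
open import Data.List.Relation.Unary.All.Properties using (all-filter)
open import Data.List.Relation.Unary.AllPairs using (_∷_; [])
open import Data.List.Relation.Unary.Any using (here; there)
open import Data.List.Relation.Unary.Unique.Propositional.Properties using (filter⁺; allFin⁺)
open import Data.Nat using (suc; _+_; _*_; _<_; z≤n; s≤s; _≤?_)
open import Data.Nat.ListAction using (sum)
open import Data.Nat.Properties
  using (+-commutativeSemigroup; *-zeroʳ; *-distribˡ-+; *-suc; +-mono-≤; +-suc; ≤-reflexive; ≤-trans; m≤n+m; +-monoʳ-≤; +-monoˡ-≤; <-irrefl; m≤n+m∸n; ≤-<-trans; ≤-refl; n≤1+n; m≤m+n; +-cancelʳ-≤; +-assoc; *-monoʳ-≤; <⇒≱; ≰⇒>; m≤n+o⇒m∸n≤o; module ≤-Reasoning)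
open import Algebra.Properties.CommutativeSemigroup +-commutativeSemigroup using (interchange)
open import Data.Nat.Tactic.RingSolver using (solve-∀)
open import Data.Product using (_,_; ∃)
open import Data.Sum using (inj₁; inj₂)
open import Function using (_∘_; _$_; id)
open import Function.Bundles using (Equivalence)
open import Relation.Nullary using (¬_; yes; no; does; ¬?)
open import Relation.Unary using (Pred; Decidable)
open import Relation.Binary.PropositionalEquality
  using (_≡_; _≢_; refl; sym; trans; cong; cong₂; subst; module ≡-Reasoning)

𝟙 : Bool → ℕ
𝟙 true  = 1
𝟙 false = 0

∑ : {A : Set} → List A → (A → ℕ) → ℕ
∑ xs f = sum (map f xs)

countᵇ : {A : Set} → (A → Bool) → List A → ℕ
countᵇ p xs = ∑ xs (𝟙 ∘ p)

module _ {A : Set} where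
  open ≡-Reasoning

  ∑-+ : ∀ (xs : List A) (f g : A → ℕ) → ∑ xs (λ a → f a + g a) ≡ ∑ xs f + ∑ xs g
  ∑-+ []       f g = refl
  ∑-+ (x ∷ xs) f g = begin
    (f x + g x) + ∑ xs (λ a → f a + g a) ≡⟨ cong (f x + g x +_) (∑-+ xs f g) ⟩
    (f x + g x) + (∑ xs f + ∑ xs g)      ≡⟨ interchange (f x) (g x) (∑ xs f) (∑ xs g) ⟩
    (f x + ∑ xs f) + (g x + ∑ xs g)      ∎

  ∑-+³ : ∀ (xs : List A) (f g h : A → ℕ) → ∑ xs (λ a → f a + g a + h a) ≡ ∑ xs f + ∑ xs g + ∑ xs h
  ∑-+³ xs f g h = trans (∑-+ xs _ h) (cong (_+ ∑ xs h) (∑-+ xs f g))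

  ∑-* : ∀ (xs : List A) k (f : A → ℕ) → ∑ xs (λ a → k * f a) ≡ k * ∑ xs f
  ∑-* []       k f = sym (*-zeroʳ k)
  ∑-* (x ∷ xs) k f = begin
    k * f x + ∑ xs (λ a → k * f a) ≡⟨ cong (k * f x +_) (∑-* xs k f) ⟩
    k * f x + k * ∑ xs f           ≡⟨ *-distribˡ-+ k (f x) (∑ xs f) ⟨
    k * (f x + ∑ xs f)             ∎

  ∑-const : ∀ (xs : List A) k → ∑ xs (λ _ → k) ≡ k * length xs
  ∑-const []       k = sym (*-zeroʳ k)
  ∑-const (x ∷ xs) k = begin
    k + ∑ xs (λ _ → k)  ≡⟨ cong (k +_) (∑-const xs k) ⟩
    k + k * length xs   ≡⟨ *-suc k (length xs) ⟨
    k * suc (length xs) ∎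

  ∑-mono : ∀ (xs : List A) {f g : A → ℕ} → (∀ a → f a ≤ g a) → ∑ xs f ≤ ∑ xs g
  ∑-mono []       f≤g = z≤n
  ∑-mono (x ∷ xs) f≤g = +-mono-≤ (f≤g x) (∑-mono xs f≤g)

  module _ {ℓ} {P : Pred A ℓ} (P? : Decidable P) where

    length-filter≡countᵇ : ∀ xs → length (filter P? xs) ≡ countᵇ (does ∘ P?) xs
    length-filter≡countᵇ []       = refl
    length-filter≡countᵇ (x ∷ xs) with does (P? x)
    ... | true  = cong suc (length-filter≡countᵇ xs)
    ... | false = length-filter≡countᵇ xs

    length-filter-¬+length-filter : ∀ xs → length (filter (¬? ∘ P?) xs) + length (filter P? xs) ≡ length xs
    length-filter-¬+length-filter []       = refl
    length-filter-¬+length-filter (x ∷ xs) with does (P? x)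
    ... | true  = trans (+-suc _ _) (cong suc (length-filter-¬+length-filter xs))
    ... | false = cong suc (length-filter-¬+length-filter xs)

  module _ {p : A → Bool} where

    countᵇ≡0 : ∀ {xs} → (∀ {a} → a ∈ᴸ xs → ¬ T (p a)) → countᵇ p xs ≡ 0
    countᵇ≡0 {[]}     _   = refl
    countᵇ≡0 {x ∷ xs} ¬pa with p x | ¬pa (here refl)
    ... | true  | ¬px = ⊥-elim (¬px _)
    ... | false | _   = countᵇ≡0 (¬pa ∘ there)

    countᵇ≤1 : ∀ {xs} → Unique xs → (∀ {a b} → a ∈ᴸ xs → b ∈ᴸ xs → T (p a) → T (p b) → a ≡ b) →
               countᵇ p xs ≤ 1
    countᵇ≤1 {[]}     _            _    = z≤n
    countᵇ≤1 {x ∷ xs} (x∉xs ∷ !xs) same with p x in px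
    ... | true  = s≤s (≤-reflexive (countᵇ≡0 λ a∈xs pa →
                    lookup x∉xs a∈xs (same (here refl) (there a∈xs) (Equivalence.from T-≡ px) pa)))
    ... | false = countᵇ≤1 !xs (λ a∈xs b∈xs → same (there a∈xs) (there b∈xs))

    1≤countᵇ : ∀ {a xs} → a ∈ᴸ xs → T (p a) → 1 ≤ countᵇ p xs
    1≤countᵇ {xs = x ∷ xs} (here refl) px with p x
    ... | true = s≤s z≤n
    1≤countᵇ {xs = x ∷ xs} (there a∈xs) pa = ≤-trans (1≤countᵇ a∈xs pa) (m≤n+m _ (𝟙 (p x)))

    1≤countᵇ⇒∃ : ∀ {xs} → 1 ≤ countᵇ p xs → ∃ λ a → a ∈ᴸ xs × T (p a)
    1≤countᵇ⇒∃ {x ∷ xs} 1≤c with p x in px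
    ... | true  = x , here refl , Equivalence.from T-≡ px
    ... | false with 1≤countᵇ⇒∃ 1≤c
    ...   | a , a∈xs , pa = a , there a∈xs , pa

x∉p∪q : ∀ {n} {x : Fin n} {p q} → x ∉ p → x ∉ q → x ∉ p ∪ q
x∉p∪q {p = p} {q} x∉p x∉q x∈p∪q with x∈p∪q⁻ p q x∈p∪q
... | inj₁ x∈p = x∉p x∈p
... | inj₂ x∈q = x∉q x∈q

x∉p⇒p⊂p∪⁅x⁆ : ∀ {n} {x : Fin n} {p} → x ∉ p → p ⊂ p ∪ ⁅ x ⁆
x∉p⇒p⊂p∪⁅x⁆ {x = x} {p} x∉p = p⊆p∪q ⁅ x ⁆ , x , x∈p∪q⁺ (inj₂ (x∈⁅x⁆ x)) , x∉p

length+∣p∣≤n : ∀ {n} {xs : List (Fin n)} {p : Subset n} → Unique xs → All (_∉ p) xs → length xs + ∣ p ∣ ≤ n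
length+∣p∣≤n {p = p} [] [] = ∣p∣≤n p
length+∣p∣≤n {n} {x ∷ xs} {p} (x≢xs ∷ !xs) (x∉p ∷ xs∉p) = begin
  suc (length xs + ∣ p ∣)     ≡⟨ +-suc (length xs) ∣ p ∣ ⟨
  length xs + suc ∣ p ∣       ≤⟨ +-monoʳ-≤ (length xs) (p⊂q⇒∣p∣<∣q∣ (x∉p⇒p⊂p∪⁅x⁆ x∉p)) ⟩
  length xs + ∣ p ∪ ⁅ x ⁆ ∣   ≤⟨ length+∣p∣≤n !xs (zipWith xs∉p∪⁅x⁆ (xs∉p , x≢xs)) ⟩
  n                           ∎
  where
  open ≤-Reasoning
  xs∉p∪⁅x⁆ : ∀ {y} → y ∉ p × x ≢ y → y ∉ p ∪ ⁅ x ⁆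
  xs∉p∪⁅x⁆ (y∉p , x≢y) = x∉p∪q y∉p (x≢y⇒x∉⁅y⁆ (x≢y ∘ sym))

⊆⋃ : ∀ {n} {As : List (Subset n)} {A} → A ∈ᴸ As → A ⊆ ⋃ As
⊆⋃ {As = B ∷ As} (here refl)  = p⊆p∪q (⋃ As)
⊆⋃ {As = B ∷ As} (there A∈As) = q⊆p∪q B (⋃ As) ∘ ⊆⋃ A∈As

_∈ᵇ_ : ∀ {n} → Fin n → Subset n → Bool
x ∈ᵇ A = does (x ∈? A)

noneOf onlyFirst onlyFirstTwo allOf : Bool → Bool → Bool → Bool
noneOf       a b c = not a ∧ not b ∧ not c
onlyFirst    a b c = a ∧ not b ∧ not c
onlyFirstTwo a b c = a ∧ b ∧ not c
allOf        a b c = a ∧ b ∧ c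

module _ {n : ℕ} (u v w : Fin n) (A : Subset n) where

  noneOf⇒ : T (noneOf (u ∈ᵇ A) (v ∈ᵇ A) (w ∈ᵇ A)) → All (_∉ A) (u ∷ v ∷ w ∷ [])
  noneOf⇒ _ with u ∈? A | v ∈? A | w ∈? A
  ... | no u∉A | no v∉A | no w∉A = u∉A ∷ v∉A ∷ w∉A ∷ []

  onlyFirst⇒ : T (onlyFirst (u ∈ᵇ A) (v ∈ᵇ A) (w ∈ᵇ A)) → u ∈ A × v ∉ A × w ∉ A
  onlyFirst⇒ _ with u ∈? A | v ∈? A | w ∈? A
  ... | yes u∈A | no v∉A | no w∉A = u∈A , v∉A , w∉A

  onlyFirstTwo⇐ : u ∈ A → v ∈ A → w ∉ A → T (onlyFirstTwo (u ∈ᵇ A) (v ∈ᵇ A) (w ∈ᵇ A))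
  onlyFirstTwo⇐ u∈A v∈A w∉A with u ∈? A | v ∈? A | w ∈? A
  ... | yes _  | yes _  | no _    = _
  ... | no u∉A | _      | _       = u∉A u∈A
  ... | yes _  | no v∉A | _       = v∉A v∈A
  ... | yes _  | yes _  | yes w∈A = w∉A w∈A

  allOf⇐ : u ∈ A → v ∈ A → w ∈ A → T (allOf (u ∈ᵇ A) (v ∈ᵇ A) (w ∈ᵇ A))
  allOf⇐ u∈A v∈A w∈A with u ∈? A | v ∈? A | w ∈? A
  ... | yes _  | yes _  | yes _  = _
  ... | no u∉A | _      | _      = u∉A u∈A
  ... | yes _  | no v∉A | _      = v∉A v∈A
  ... | yes _  | yes _  | no w∉A = w∉A w∈A

#⟨_⟩ : ∀ {n} → (Bool → Bool → Bool → Bool) → Family n → Fin n → Fin n → Fin n → ℕ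
#⟨ p ⟩ F u v w = countᵇ (λ A → p (u ∈ᵇ A) (v ∈ᵇ A) (w ∈ᵇ A)) (sets F)

freq≡countᵇ : ∀ {n} (i : Fin n) (F : Family n) → freq i F ≡ countᵇ (i ∈ᵇ_) (sets F)
freq≡countᵇ i F = length-filter≡countᵇ (i ∈?_) (sets F)

NonemptyAtLeast : ∀ {n} → Family n → ℕ → Set
NonemptyAtLeast F k = ∀ A → A ∈F F → 1 ≤ ∣ A ∣ → k ≤ ∣ A ∣

module _ {n : ℕ} (F : Family n) where

  ⋃∈F : UnionClosed F → ⊥ ∈F F → ∀ {As} → All (_∈F F) As → ⋃ As ∈F F
  ⋃∈F closed ∅∈F []           = ∅∈F
  ⋃∈F closed ∅∈F (A∈F ∷ As∈F) = closed _ _ A∈F (⋃∈F closed ∅∈F As∈F)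

  ⊤∈F : UnionClosed F → ⊥ ∈F F → CoversAll F → ⊤ ∈F F
  ⊤∈F closed ∅∈F covers = subst (_∈F F) (⊆-antisym ⊆⊤ ⊤⊆⋃F) (⋃∈F closed ∅∈F (tabulate id))
    where
    ⊤⊆⋃F : ⊤ ⊆ ⋃ (sets F)
    ⊤⊆⋃F {i} _ with covers i
    ... | A , A∈F , i∈A = ⊆⋃ A∈F i∈A

  1≤#allOf : UnionClosed F → ⊥ ∈F F → CoversAll F → ∀ u v w → 1 ≤ #⟨ allOf ⟩ F u v w
  1≤#allOf closed ∅∈F covers u v w = 1≤countᵇ (⊤∈F closed ∅∈F covers) (allOf⇐ u v w ⊤ ∈⊤ ∈⊤ ∈⊤)

  onlyFirst-∪ : UnionClosed F → ∀ {u v w} → 1 ≤ #⟨ onlyFirst ⟩ F u v w → 1 ≤ #⟨ onlyFirst ⟩ F v u w →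
                1 ≤ #⟨ onlyFirstTwo ⟩ F u v w
  onlyFirst-∪ closed {u} {v} {w} 1≤#u 1≤#v with 1≤countᵇ⇒∃ 1≤#u | 1≤countᵇ⇒∃ 1≤#v
  ... | A , A∈F , tA | B , B∈F , tB with onlyFirst⇒ u v w A tA | onlyFirst⇒ v u w B tB
  ... | u∈A , _ , w∉A | v∈B , _ , w∉B =
    1≤countᵇ (closed A B A∈F B∈F)
      (onlyFirstTwo⇐ u v w (A ∪ B) (p⊆p∪q B u∈A) (q⊆p∪q A B v∈B) (x∉p∪q w∉A w∉B))

  module _ (large : NonemptyAtLeast F (n ∸ 2)) where

    misses-three⇒≡⊥ : ∀ {A u v w} → A ∈F F → Unique (u ∷ v ∷ w ∷ []) → All (_∉ A) (u ∷ v ∷ w ∷ []) →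
                      A ≡ ⊥
    misses-three⇒≡⊥ {A} A∈F !uvw uvw∉A = Empty-unique λ (t , t∈A) → <-irrefl refl $ begin-strict
      n            ≤⟨ m≤n+m∸n n 2 ⟩
      2 + (n ∸ 2)  ≤⟨ +-monoʳ-≤ 2 (large A A∈F (≤-<-trans z≤n (x∈p⇒∣p-x∣<∣p∣ t∈A))) ⟩
      2 + ∣ A ∣    <⟨ ≤-refl ⟩
      3 + ∣ A ∣    ≤⟨ length+∣p∣≤n !uvw uvw∉A ⟩
      n            ∎
      where open ≤-Reasoning

    misses-two⇒⊆ : ∀ {A B u v w} → v ≢ w → B ∈F F → u ∈ B → v ∉ B → w ∉ B → v ∉ A → w ∉ A → A ⊆ B
    misses-two⇒⊆ {A} {B} {u} {v} {w} v≢w B∈F u∈B v∉B w∉B v∉A w∉A {t} t∈A with t ∈? B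
    ... | yes t∈B = t∈B
    ... | no  t∉B = ⊥-elim (∉⊥ (subst (u ∈_) B≡⊥ u∈B))
      where
      B≡⊥ : B ≡ ⊥
      B≡⊥ = misses-three⇒≡⊥ B∈F
              ((v≢w ∷ (λ v≡t → v∉A (subst (_∈ A) (sym v≡t) t∈A)) ∷ [])
               ∷ ((λ w≡t → w∉A (subst (_∈ A) (sym w≡t) t∈A)) ∷ []) ∷ [] ∷ [])
              (v∉B ∷ w∉B ∷ t∉B ∷ [])

    #noneOf≤1 : ∀ {u v w} → Unique (u ∷ v ∷ w ∷ []) → #⟨ noneOf ⟩ F u v w ≤ 1
    #noneOf≤1 {u} {v} {w} !uvw = countᵇ≤1 (unique F) λ {A} {B} A∈F B∈F tA tB →
      trans (misses-three⇒≡⊥ A∈F !uvw (noneOf⇒ u v w A tA))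
            (sym (misses-three⇒≡⊥ B∈F !uvw (noneOf⇒ u v w B tB)))

    #onlyFirst≤1 : ∀ {u v w} → v ≢ w → #⟨ onlyFirst ⟩ F u v w ≤ 1
    #onlyFirst≤1 {u} {v} {w} v≢w = countᵇ≤1 (unique F) λ {A} {B} A∈F B∈F tA tB →
      let (u∈A , v∉A , w∉A) = onlyFirst⇒ u v w A tA
          (u∈B , v∉B , w∉B) = onlyFirst⇒ u v w B tB
      in ⊆-antisym (misses-two⇒⊆ v≢w B∈F u∈B v∉B w∉B v∉A w∉A)
                   (misses-two⇒⊆ v≢w A∈F u∈A v∉A w∉A v∉B w∉B)

-- Summed over F, gain is 2(f_x + f_y + f_z) and cost is 3|F|, each corrected by
-- the numbers of members with the membership patterns that the structure of F bounds.
cost gain : Bool → Bool → Bool → ℕ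
cost a b c = 3 + 3 * 𝟙 (allOf a b c) + 𝟙 (onlyFirstTwo a b c)
gain a b c = 2 * (𝟙 a + 𝟙 b + 𝟙 c) + 3 * 𝟙 (noneOf a b c)
             + (𝟙 (onlyFirst a b c) + 𝟙 (onlyFirst b a c) + 𝟙 (onlyFirst c a b))

cost≤gain : ∀ a b c → cost a b c ≤ gain a b c
cost≤gain true  true  true  = ≤-refl
cost≤gain true  true  false = ≤-refl
cost≤gain true  false true  = n≤1+n 3
cost≤gain false true  true  = n≤1+n 3
cost≤gain true  false false = ≤-refl
cost≤gain false true  false = ≤-refl
cost≤gain false false true  = ≤-refl
cost≤gain false false false = ≤-refl
double-count : ∀ {n} (F : Family n) (x y z : Fin n) →
  3 * size F + 3 * #⟨ allOf ⟩ F x y z + #⟨ onlyFirstTwo ⟩ F x y z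
  ≤ 2 * (freq x F + freq y F + freq z F) + 3 * #⟨ noneOf ⟩ F x y z
    + (#⟨ onlyFirst ⟩ F x y z + #⟨ onlyFirst ⟩ F y x z + #⟨ onlyFirst ⟩ F z x y)
double-count {n} F x y z = begin
  3 * size F + 3 * #⟨ allOf ⟩ F x y z + #⟨ onlyFirstTwo ⟩ F x y z   ≡⟨ ∑-cost ⟨
  ∑ xs (on-bits cost)                                                ≤⟨ ∑-mono xs (on-bits cost≤gain) ⟩
  ∑ xs (on-bits gain)                                                ≡⟨ ∑-gain ⟩
  2 * (freq x F + freq y F + freq z F) + 3 * #⟨ noneOf ⟩ F x y z
    + (#⟨ onlyFirst ⟩ F x y z + #⟨ onlyFirst ⟩ F y x z + #⟨ onlyFirst ⟩ F z x y) ∎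
  where
  open ≤-Reasoning
  xs : List (Subset n)
  xs = sets F

  on-bits : ∀ {B : Bool → Bool → Bool → Set} → (∀ a b c → B a b c) → (A : Subset n) → B (x ∈ᵇ A) (y ∈ᵇ A) (z ∈ᵇ A)
  on-bits f A = f (x ∈ᵇ A) (y ∈ᵇ A) (z ∈ᵇ A)

  [_] : Fin n → Subset n → ℕ
  [ i ] A = 𝟙 (i ∈ᵇ A)

  ∑-cost : ∑ xs (on-bits cost) ≡ 3 * size F + 3 * #⟨ allOf ⟩ F x y z + #⟨ onlyFirstTwo ⟩ F x y z
  ∑-cost = begin-equality
    ∑ xs (on-bits cost)                                                          ≡⟨ ∑-+³ xs _ _ _ ⟩
    ∑ xs (λ _ → 3) + ∑ xs (λ A → 3 * 𝟙 (on-bits allOf A)) + #⟨ onlyFirstTwo ⟩ F x y z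
      ≡⟨ cong₂ (λ a b → a + b + #⟨ onlyFirstTwo ⟩ F x y z) (∑-const xs 3) (∑-* xs 3 (𝟙 ∘ on-bits allOf)) ⟩
    3 * size F + 3 * #⟨ allOf ⟩ F x y z + #⟨ onlyFirstTwo ⟩ F x y z ∎

  ∑-gain : ∑ xs (on-bits gain) ≡ 2 * (freq x F + freq y F + freq z F) + 3 * #⟨ noneOf ⟩ F x y z
                                 + (#⟨ onlyFirst ⟩ F x y z + #⟨ onlyFirst ⟩ F y x z + #⟨ onlyFirst ⟩ F z x y)
  ∑-gain = begin-equality
    ∑ xs (on-bits gain)                                                            ≡⟨ ∑-+³ xs _ _ _ ⟩
    ∑ xs (λ A → 2 * ([ x ] A + [ y ] A + [ z ] A)) + ∑ xs (λ A → 3 * 𝟙 (on-bits noneOf A))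
      + ∑ xs (λ A → 𝟙 (on-bits onlyFirst A) + 𝟙 (onlyFirst (y ∈ᵇ A) (x ∈ᵇ A) (z ∈ᵇ A)) + 𝟙 (onlyFirst (z ∈ᵇ A) (x ∈ᵇ A) (y ∈ᵇ A)))
      ≡⟨ cong₂ _+_ (cong₂ _+_ ∑-ones (∑-* xs 3 (𝟙 ∘ on-bits noneOf))) (∑-+³ xs _ _ _) ⟩
    2 * (freq x F + freq y F + freq z F) + 3 * #⟨ noneOf ⟩ F x y z
      + (#⟨ onlyFirst ⟩ F x y z + #⟨ onlyFirst ⟩ F y x z + #⟨ onlyFirst ⟩ F z x y) ∎
    where
    ∑-ones : ∑ xs (λ A → 2 * ([ x ] A + [ y ] A + [ z ] A)) ≡ 2 * (freq x F + freq y F + freq z F)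
    ∑-ones = begin-equality
      ∑ xs (λ A → 2 * ([ x ] A + [ y ] A + [ z ] A))  ≡⟨ ∑-* xs 2 _ ⟩
      2 * ∑ xs (λ A → [ x ] A + [ y ] A + [ z ] A)    ≡⟨ cong (2 *_) (∑-+³ xs [ x ] [ y ] [ z ]) ⟩
      2 * (∑ xs [ x ] + ∑ xs [ y ] + ∑ xs [ z ])
        ≡⟨ cong (2 *_) (cong₂ _+_ (cong₂ _+_ (freq≡countᵇ x F) (freq≡countᵇ y F)) (freq≡countᵇ z F)) ⟨
      2 * (freq x F + freq y F + freq z F)            ∎

m+n+o≤2+p : ∀ {m n o p} → m ≤ 1 → n ≤ 1 → o ≤ 1 → (1 ≤ m → 1 ≤ n → 1 ≤ p) → m + n + o ≤ 2 + p
m+n+o≤2+p z≤n       n≤1       o≤1 _   = ≤-trans (+-mono-≤ n≤1 o≤1) (m≤m+n 2 _)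
m+n+o≤2+p (s≤s z≤n) z≤n       o≤1 _   = ≤-trans (s≤s o≤1) (m≤m+n 2 _)
m+n+o≤2+p (s≤s z≤n) (s≤s z≤n) o≤1 1≤p = s≤s (s≤s (≤-trans o≤1 (1≤p (s≤s z≤n) (s≤s z≤n))))

2*[m+n+o]+2<3*p : ∀ {m n o p} → 2 * m < p → 2 * n < p → 2 * o < p → 2 * (m + n + o) + 2 < 3 * p
2*[m+n+o]+2<3*p {m} {n} {o} {p} 2m<p 2n<p 2o<p = begin
  suc (2 * (m + n + o) + 2)                ≡⟨ regroup m n o ⟩
  suc (2 * m) + suc (2 * n) + suc (2 * o)  ≤⟨ +-mono-≤ (+-mono-≤ 2m<p 2n<p) 2o<p ⟩
  p + p + p                                ≡⟨ triple p ⟩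
  3 * p                                    ∎
  where
  open ≤-Reasoning
  regroup : ∀ m n o → suc (2 * (m + n + o) + 2) ≡ suc (2 * m) + suc (2 * n) + suc (2 * o)
  regroup = solve-∀
  triple : ∀ p → p + p + p ≡ 3 * p
  triple = solve-∀

module _ {n : ℕ} (F : Family n) (closed : UnionClosed F) (∅∈F : ⊥ ∈F F) (covers : CoversAll F)
         (large : NonemptyAtLeast F (n ∸ 2)) where

  three-frequencies : ∀ {x y z} → Unique (x ∷ y ∷ z ∷ []) →
                      3 * size F ≤ 2 * (freq x F + freq y F + freq z F) + 2
  three-frequencies {x} {y} {z} !xyz@((x≢y ∷ x≢z ∷ []) ∷ (y≢z ∷ []) ∷ [] ∷ []) =
    +-cancelʳ-≤ (3 + #xy) (3 * size F) (2 * f + 2) $ begin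
      3 * size F + (3 + #xy)                   ≤⟨ +-monoʳ-≤ (3 * size F) (+-monoˡ-≤ #xy (*-monoʳ-≤ 3 1≤#xyz)) ⟩
      3 * size F + (3 * #xyz + #xy)            ≡⟨ +-assoc (3 * size F) _ _ ⟨
      3 * size F + 3 * #xyz + #xy              ≤⟨ double-count F x y z ⟩
      2 * f + 3 * #∅ + (#x + #y + #z)          ≤⟨ +-mono-≤ (+-monoʳ-≤ (2 * f) (*-monoʳ-≤ 3 #∅≤1)) #singles≤ ⟩
      2 * f + 3 + (2 + #xy)                    ≡⟨ swap (2 * f) #xy ⟩
      2 * f + 2 + (3 + #xy)                    ∎
    where
    open ≤-Reasoning
    f #∅ #x #y #z #xy #xyz : ℕ
    f = freq x F + freq y F + freq z F
    #∅ = #⟨ noneOf ⟩ F x y z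
    #x = #⟨ onlyFirst ⟩ F x y z
    #y = #⟨ onlyFirst ⟩ F y x z
    #z = #⟨ onlyFirst ⟩ F z x y
    #xy = #⟨ onlyFirstTwo ⟩ F x y z
    #xyz = #⟨ allOf ⟩ F x y z

    1≤#xyz : 1 ≤ #xyz
    1≤#xyz = 1≤#allOf F closed ∅∈F covers x y z

    #∅≤1 : #∅ ≤ 1
    #∅≤1 = #noneOf≤1 F large !xyz

    #singles≤ : #x + #y + #z ≤ 2 + #xy
    #singles≤ = m+n+o≤2+p (#onlyFirst≤1 F large {x} y≢z)
                  (#onlyFirst≤1 F large {y} x≢z) (#onlyFirst≤1 F large {z} x≢y)
                  (onlyFirst-∪ F closed {x} {y} {z})

    swap : ∀ a b → a + 3 + (2 + b) ≡ a + 2 + (3 + b)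
    swap = solve-∀

  at-most-two-scarce : ∀ {L} → Unique L → All (¬_ ∘ Abundant F) L → length L ≤ 2
  at-most-two-scarce {[]}         _ _ = z≤n
  at-most-two-scarce {_ ∷ []}     _ _ = s≤s z≤n
  at-most-two-scarce {_ ∷ _ ∷ []} _ _ = s≤s (s≤s z≤n)
  at-most-two-scarce {x ∷ y ∷ z ∷ _} ((x≢y ∷ x≢z ∷ _) ∷ (y≢z ∷ _) ∷ _) (¬x ∷ ¬y ∷ ¬z ∷ _) =
    ⊥-elim (<⇒≱ (2*[m+n+o]+2<3*p {freq x F} {freq y F} {freq z F} (≰⇒> ¬x) (≰⇒> ¬y) (≰⇒> ¬z))
                (three-frequencies ((x≢y ∷ x≢z ∷ []) ∷ (y≢z ∷ []) ∷ [] ∷ [])))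

mainTheorem4 : (n : ℕ) → 4 ≤ n → (F : Family n) → UnionClosed F → ⊥ ∈F F → CoversAll F
    → HasT F (n ∸ 2)
    → Σ (List (Fin n)) λ L → Unique L × n ∸ 2 ≤ length L × All (Abundant F) L
mainTheorem4 n _ F closed ∅∈F covers (_ , large) =
  abundant , filter⁺ Abundant? (allFin⁺ n) , n∸2≤#abundant , all-filter Abundant? (allFin n)
  where
  open ≤-Reasoning
  Abundant? : Decidable (Abundant F)
  Abundant? i = size F ≤? 2 * freq i F
  abundant scarce : List (Fin n)
  abundant = filter Abundant? (allFin n)
  scarce   = filter (¬? ∘ Abundant?) (allFin n)

  n∸2≤#abundant : n ∸ 2 ≤ length abundant
  n∸2≤#abundant = m≤n+o⇒m∸n≤o n 2 $ begin
    n                                   ≡⟨ length-tabulate {A = Fin n} id ⟨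
    length (allFin n)                   ≡⟨ length-filter-¬+length-filter Abundant? (allFin n) ⟨
    length scarce + length abundant     ≤⟨ +-monoˡ-≤ (length abundant) #scarce≤2 ⟩
    2 + length abundant                 ∎
    where
    #scarce≤2 : length scarce ≤ 2
    #scarce≤2 = at-most-two-scarce F closed ∅∈F covers large
                  (filter⁺ (¬? ∘ Abundant?) (allFin⁺ n)) (all-filter (¬? ∘ Abundant?) (allFin n))
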